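{- Let $p\le q$ be $n$-symmetric lattice paths and $k$ an integer such that $\Delta[p,q]$ has a feasible set of size $k$. Then the $k$-th homogeneous component $\Delta[p,q]^k$ is a lattice path matroid.
   Context: An $n$-symmetric lattice path is a path from $(0,0)$ to $(n,n)$ of $2n$ unit steps $E=(1,0)$, $N=(0,1)$, a word $\alpha_1\cdots\alpha_{2n}$ with $\alpha_i\ne\alpha_{2n-i+1}$ for $i\le n$; $p\le r$ means $p$ lies weakly below $r$. $\operatorname{lab}^L(r)$: label steps in order by $-n,\dots,-1,1,\dots,n$ and record the labels of $E$ steps. $\Delta[p,q]$ is the delta matroid on $[n]$ with feasible sets $\operatorname{lab}^L(r)\cap[n]$ for symmetric $r$, $p\le r\le q$. The $k$-th homogeneous component is the matroid whose bases are the feasible sets of size $k$. A lattice path matroid of rank $k$ on a totally ordered finite ground set is a matroid whose bases are all $k$-subsets $R$ with $A\le R\le B$ for some $k$-subsets $A\le B$, in the type $A$ Gale order ($\{a_1<\dots<a_k\}\le\{b_1<\dots<b_k\}$ iff $a_i\le b_i$ for all $i$); equivalently, bases are in bijection (via positions of $E$ steps) with lattice paths between two fixed bounding lattice paths. -}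

module Defs where

open import Data.Nat using (ℕ; zero; suc; _+_)
open import Data.Bool using (Bool; true; false)
open import Data.Fin using (Fin; toℕ; opposite; _↑ʳ_) renaming (_≤_ to _≤ᶠ_)
open import Data.Fin.Subset using (Subset; inside; outside; ∣_∣)
open import Data.Vec using (Vec; []; _∷_; lookup; tabulate; toList)
open import Data.List using (List; []; _∷_; take; map)
open import Data.List.Relation.Binary.Pointwise using (Pointwise)
open import Data.Product using (Σ; ∃; _×_)
open import Relation.Binary.PropositionalEquality using (_≡_; _≢_)
import Data.Nat as ℕ

-- Unit steps E = (1,0) and N = (0,1).
data Step : Set where
  E N : Step

-- A word of 2n steps α₁ ⋯ α₂ₙ (position i : Fin (n + n) is α_{i+1}).
Word : ℕ → Set
Word n = Vec Step (n + n)

countE : List Step → ℕ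
countE [] = 0
countE (E ∷ s) = suc (countE s)
countE (N ∷ s) = countE s

-- number of E steps among the first t steps (x-coordinate after t steps)
eAfter : ∀ n → Word n → ℕ → ℕ
eAfter n α t = countE (take t (toList α))

IsLatticePath : ∀ n → Word n → Set
IsLatticePath n α = eAfter n α (n + n) ≡ n

-- n-symmetric: α_i ≠ α_{2n-i+1} for i ≤ n  (opposite i has toℕ = 2n-1-toℕ i)
IsSymmetric : ∀ n → Word n → Set
IsSymmetric n α = (i : Fin (n + n)) → toℕ i ℕ.< n → lookup α i ≢ lookup α (opposite i)

record SymPath (n : ℕ) : Set where
  constructor mkSymPath
  field
    word : Word n
    isPath : IsLatticePath n word
    isSym : IsSymmetric n word
open SymPath public

-- p ≤ r : p lies weakly below r, i.e. after every number t of steps,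
-- p has taken at least as many E steps as r
_≼_ : ∀ {n} → SymPath n → SymPath n → Set
_≼_ {n} p r = (t : ℕ) → eAfter n (word r) t ℕ.≤ eAfter n (word p) t

isE : Step → Bool
isE E = true
isE N = false

-- lab^L(r) ∩ [n]: steps are labelled -n,…,-1,1,…,n in order, so the step at
-- position n + j (j : Fin n) carries label j+1.  Element j : Fin n of a
-- Subset n stands for the label j+1 ∈ [n].
labL∩ : ∀ {n} → SymPath n → Subset n
labL∩ {n} r = tabulate (λ j → isE (lookup (word r) (n ↑ʳ j)))

Feasible : ∀ {n} → SymPath n → SymPath n → Subset n → Set
Feasible p q F = Σ (SymPath _) λ r → p ≼ r × r ≼ q × labL∩ r ≡ F

ComponentBasis : ∀ {n} → SymPath n → SymPath n → ℕ → Subset n → Set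
ComponentBasis p q k F = Feasible p q F × ∣ F ∣ ≡ k

elems : ∀ {n} → Subset n → List (Fin n)
elems [] = []
elems (inside ∷ s) = Fin.zero ∷ map Fin.suc (elems s)
  where import Data.Fin as Fin
elems (outside ∷ s) = map Fin.suc (elems s)
  where import Data.Fin as Fin

_≤G_ : ∀ {n} → Subset n → Subset n → Set
A ≤G B = Pointwise _≤ᶠ_ (elems A) (elems B)

IsLatticePathMatroid : ∀ n → ℕ → (Subset n → Set) → Set
IsLatticePathMatroid n k 𝓑 =
  Σ (Subset n) λ A → Σ (Subset n) λ B →
    ∣ A ∣ ≡ k × ∣ B ∣ ≡ k × A ≤G B ×
    ((R : Subset n) →
      (𝓑 R → ∣ R ∣ ≡ k × A ≤G R × R ≤G B) ×
      (∣ R ∣ ≡ k × A ≤G R × R ≤G B → 𝓑 R))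

-- A symmetric path r is determined by F = lab^L(r) ∩ [n], the E steps of the second half of its
-- word; its first half is the mirror image, and after n + s steps it has taken n + #(F ∩ [0,s)) − |F|
-- E steps.  Hence p ≼ r ≼ q with |F| = k says exactly that the prefix counts s ↦ #(F ∩ [0,s)) lie in a
-- band lower ≤ · ≤ upper of functions that rise by 0 or 1 at each step and both end at k.  The
-- k-subsets whose prefix counts lie in such a band form a lattice path matroid: a k-subset is Gale
-- below another iff its prefix counts are pointwise at least as large, and the pointwise largest and
-- smallest admissible count functions are themselves prefix counts of k-subsets in the band.
module Submission where

open import Defs
open import Data.Bool using (Bool; true; false)
open import Data.Empty using (⊥-elim)
open import Data.Fin as Fin using (Fin; toℕ; fromℕ<; opposite; splitAt; _↑ˡ_; _↑ʳ_)
open import Data.Fin.Properties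
  using (toℕ-fromℕ<; toℕ-↑ˡ; toℕ-↑ʳ; toℕ-injective; toℕ<n; opposite-prop;
         splitAt-↑ˡ; splitAt-↑ʳ; splitAt⁻¹-↑ˡ; splitAt⁻¹-↑ʳ)
open import Data.Fin.Subset using (Subset; ∣_∣)
open import Data.Fin.Subset.Properties using (∣p∣≤n)
open import Data.List as List using (List; []; _∷_; take; length)
open import Data.List.Properties using (length-map)
open import Data.List.Relation.Binary.Pointwise using (Pointwise; []; _∷_)
open import Data.List.Relation.Unary.All as All using (All; []; _∷_)
import Data.List.Relation.Unary.All.Properties as All
open import Data.List.Relation.Unary.AllPairs as AllPairs using (AllPairs; []; _∷_)
import Data.List.Relation.Unary.AllPairs.Properties as AllPairs
open import Data.Nat
  using (ℕ; zero; suc; _+_; _∸_; _≤_; _<_; z≤n; s≤s; z<s; s<s; _⊓_; _⊔_; _<ᵇ_; _<?_; _≤?_)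
open import Data.Nat.Properties
open import Algebra.Properties.CommutativeSemigroup +-commutativeSemigroup using (xy∙z≈xz∙y; xy∙z≈x∙zy)
open import Data.Product using (∃; _×_; _,_; proj₁; proj₂)
open import Data.Sum using (_⊎_; inj₁; inj₂; [_,_])
open import Data.Vec using (Vec; []; _∷_; lookup; tabulate; toList)
open import Data.Vec.Properties using (lookup∘tabulate; tabulate-cong; tabulate∘lookup; length-toList)
open import Function using (_∘_; _⇔_; mk⇔; Equivalence)
import Function.Properties.Equivalence as ⇔
open import Relation.Nullary using (yes; no)
open import Relation.Nullary.Decidable using (isYes)
open import Relation.Binary.PropositionalEquality
  using (_≡_; _≢_; refl; sym; trans; cong; cong₂; subst; subst₂; module ≡-Reasoning)

-- Prefix counts of subsets

bit : Bool → ℕ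
bit true  = 1
bit false = 0

bit≤1 : ∀ b → bit b ≤ 1
bit≤1 true  = s≤s z≤n
bit≤1 false = z≤n

countBelow : ∀ {n} → Subset n → ℕ → ℕ
countBelow []      _       = 0
countBelow (_ ∷ _) zero    = 0
countBelow (b ∷ F) (suc s) = bit b + countBelow F s

countBelow-zero : ∀ {n} (F : Subset n) → countBelow F 0 ≡ 0
countBelow-zero []      = refl
countBelow-zero (_ ∷ _) = refl

∣p∣≡countBelow : ∀ {n} (F : Subset n) → ∣ F ∣ ≡ countBelow F n
∣p∣≡countBelow []          = refl
∣p∣≡countBelow (true ∷ F)  = cong suc (∣p∣≡countBelow F)
∣p∣≡countBelow (false ∷ F) = ∣p∣≡countBelow F

countBelow≤s : ∀ {n} (F : Subset n) s → countBelow F s ≤ s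
countBelow≤s []          _       = z≤n
countBelow≤s (_ ∷ _)     zero    = z≤n
countBelow≤s (true ∷ F)  (suc s) = s≤s (countBelow≤s F s)
countBelow≤s (false ∷ F) (suc s) = m≤n⇒m≤1+n (countBelow≤s F s)

countBelow≤∣p∣ : ∀ {n} (F : Subset n) s → countBelow F s ≤ ∣ F ∣
countBelow≤∣p∣ []          _       = z≤n
countBelow≤∣p∣ (_ ∷ _)     zero    = z≤n
countBelow≤∣p∣ (true ∷ F)  (suc s) = s≤s (countBelow≤∣p∣ F s)
countBelow≤∣p∣ (false ∷ F) (suc s) = countBelow≤∣p∣ F s

s+∣p∣≤n+countBelow : ∀ {n} (F : Subset n) {s} → s ≤ n → s + ∣ F ∣ ≤ n + countBelow F s
s+∣p∣≤n+countBelow []          z≤n = z≤n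
s+∣p∣≤n+countBelow (b ∷ F)     z≤n = ≤-trans (∣p∣≤n (b ∷ F)) (≤-reflexive (sym (+-identityʳ _)))
s+∣p∣≤n+countBelow (true ∷ F)  {suc s} (s≤s s≤n) =
  s≤s (subst₂ _≤_ (sym (+-suc s _)) (sym (+-suc _ _)) (s≤s (s+∣p∣≤n+countBelow F s≤n)))
s+∣p∣≤n+countBelow (false ∷ F) (s≤s s≤n) = s≤s (s+∣p∣≤n+countBelow F s≤n)

countBelow-⊓ : ∀ {n} (F : Subset n) s → countBelow F s ≡ countBelow F (s ⊓ n)
countBelow-⊓ []      _       = refl
countBelow-⊓ (_ ∷ _) zero    = refl
countBelow-⊓ (b ∷ F) (suc s) = cong (bit b +_) (countBelow-⊓ F s)

UnitStep : (ℕ → ℕ) → ℕ → Set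
UnitStep f s = f s ≤ f (suc s) × f (suc s) ≤ suc (f s)

countBelow-unitStep : ∀ {n} (F : Subset n) s → UnitStep (countBelow F) s
countBelow-unitStep []          _       = z≤n , z≤n
countBelow-unitStep (true ∷ F)  zero    = z≤n , s≤s (≤-reflexive (countBelow-zero F))
countBelow-unitStep (false ∷ F) zero    = z≤n , ≤-trans (≤-reflexive (countBelow-zero F)) z≤n
countBelow-unitStep (true ∷ F)  (suc s) = let (up , step) = countBelow-unitStep F s in s≤s up , s≤s step
countBelow-unitStep (false ∷ F) (suc s) = countBelow-unitStep F s

unitStep-id : ∀ s → UnitStep (λ s → s) s
unitStep-id s = n≤1+n s , ≤-refl

unitStep-const : ∀ k s → UnitStep (λ _ → k) s
unitStep-const k s = ≤-refl , n≤1+n k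

unitStep-⊓ : ∀ f g {s} → UnitStep f s → UnitStep g s → UnitStep (λ s → f s ⊓ g s) s
unitStep-⊓ f g (f↑ , f⇡) (g↑ , g⇡) = ⊓-mono-≤ f↑ g↑ , ⊓-mono-≤ f⇡ g⇡

unitStep-⊔ : ∀ f g {s} → UnitStep f s → UnitStep g s → UnitStep (λ s → f s ⊔ g s) s
unitStep-⊔ f g (f↑ , f⇡) (g↑ , g⇡) = ⊔-mono-≤ f↑ g↑ , ⊔-mono-≤ f⇡ g⇡

unitStep-+∸ : ∀ f k m {s} → UnitStep f s → UnitStep (λ s → (f s + k) ∸ m) s
unitStep-+∸ f k m {s} (f↑ , f⇡) =
  ∸-monoˡ-≤ m (+-monoˡ-≤ k f↑) ,
  ≤-trans (∸-monoˡ-≤ m (+-monoˡ-≤ k f⇡)) (m≤n+o⇒m∸n≤o (suc x) m suc-x≤m+[1+x∸m])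
  where
  x : ℕ
  x = f s + k
  suc-x≤m+[1+x∸m] : suc x ≤ m + suc (x ∸ m)
  suc-x≤m+[1+x∸m] = ≤-trans (s≤s (m≤n+m∸n x m)) (≤-reflexive (sym (+-suc m (x ∸ m))))

fromCounts : ∀ n → (ℕ → ℕ) → Subset n
fromCounts zero    f = []
fromCounts (suc n) f = isYes (f 0 <? f 1) ∷ fromCounts n (f ∘ suc)

bit-<?+≡ : ∀ {a b} → a ≤ b → b ≤ suc a → bit (isYes (a <? b)) + a ≡ b
bit-<?+≡ {a} {b} a≤b b≤1+a with a <? b
... | yes a<b = ≤-antisym a<b b≤1+a
... | no  a≮b = ≤-antisym a≤b (≮⇒≥ a≮b)

countBelow-fromCounts+f0 : ∀ n f → (∀ s → s < n → UnitStep f s) →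
  ∀ {s} → s ≤ n → countBelow (fromCounts n f) s + f 0 ≡ f s
countBelow-fromCounts+f0 zero    f _     z≤n = refl
countBelow-fromCounts+f0 (suc n) f _     {zero} _ = refl
countBelow-fromCounts+f0 (suc n) f steps {suc s} (s≤s s≤n) = begin
  bit b + c + f 0    ≡⟨ cong (_+ f 0) (+-comm (bit b) c) ⟩
  c + bit b + f 0    ≡⟨ +-assoc c (bit b) (f 0) ⟩
  c + (bit b + f 0)  ≡⟨ cong (c +_) (bit-<?+≡ (proj₁ (steps 0 z<s)) (proj₂ (steps 0 z<s))) ⟩
  c + f 1            ≡⟨ countBelow-fromCounts+f0 n (f ∘ suc) (λ s s<n → steps (suc s) (s<s s<n)) s≤n ⟩
  f (suc s)          ∎
  where
  open ≡-Reasoning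
  b : Bool
  b = isYes (f 0 <? f 1)
  c : ℕ
  c = countBelow (fromCounts n (f ∘ suc)) s

countBelow-fromCounts : ∀ n f → f 0 ≡ 0 → (∀ s → s < n → UnitStep f s) →
  ∀ {s} → s ≤ n → countBelow (fromCounts n f) s ≡ f s
countBelow-fromCounts n f f0≡0 steps {s} s≤n = begin
  countBelow (fromCounts n f) s        ≡⟨ sym (+-identityʳ _) ⟩
  countBelow (fromCounts n f) s + 0    ≡⟨ cong (countBelow (fromCounts n f) s +_) (sym f0≡0) ⟩
  countBelow (fromCounts n f) s + f 0  ≡⟨ countBelow-fromCounts+f0 n f steps s≤n ⟩
  f s                                  ∎
  where open ≡-Reasoning

-- The Gale order through prefix counts

below : ∀ {n} → List (Fin n) → ℕ → ℕ
below []      x = 0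
below (a ∷ l) x = bit (toℕ a <ᵇ x) + below l x

below-zero : ∀ {n} (l : List (Fin n)) → below l 0 ≡ 0
below-zero []      = refl
below-zero (_ ∷ l) = below-zero l

below-map-suc : ∀ {n} (l : List (Fin n)) x → below (List.map Fin.suc l) (suc x) ≡ below l x
below-map-suc []      x = refl
below-map-suc (a ∷ l) x = cong (bit (toℕ a <ᵇ x) +_) (below-map-suc l x)

countBelow≡below-elems : ∀ {n} (X : Subset n) s → countBelow X s ≡ below (elems X) s
countBelow≡below-elems []          s       = refl
countBelow≡below-elems (true ∷ X)  zero    = sym (below-zero (List.map Fin.suc (elems X)))
countBelow≡below-elems (false ∷ X) zero    = sym (below-zero (List.map Fin.suc (elems X)))
countBelow≡below-elems (true ∷ X)  (suc s) =
  cong suc (trans (countBelow≡below-elems X s) (sym (below-map-suc (elems X) s)))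
countBelow≡below-elems (false ∷ X) (suc s) =
  trans (countBelow≡below-elems X s) (sym (below-map-suc (elems X) s))

length-elems : ∀ {n} (X : Subset n) → length (elems X) ≡ ∣ X ∣
length-elems []          = refl
length-elems (true ∷ X)  = cong suc (trans (length-map Fin.suc (elems X)) (length-elems X))
length-elems (false ∷ X) = trans (length-map Fin.suc (elems X)) (length-elems X)

elems-sorted : ∀ {n} (X : Subset n) → AllPairs Fin._<_ (elems X)
elems-sorted []          = []
elems-sorted (true ∷ X)  =
  All.map⁺ (All.universal (λ _ → z<s) (elems X)) ∷ AllPairs.map⁺ (AllPairs.map s<s (elems-sorted X))
elems-sorted (false ∷ X) = AllPairs.map⁺ (AllPairs.map s<s (elems-sorted X))

bit-<ᵇ-antitone : ∀ {a b} x → a ≤ b → bit (b <ᵇ x) ≤ bit (a <ᵇ x)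
bit-<ᵇ-antitone                 zero    _         = z≤n
bit-<ᵇ-antitone {zero}  {b}     (suc x) _         = bit≤1 (b <ᵇ suc x)
bit-<ᵇ-antitone {suc a} {suc b} (suc x) (s≤s a≤b) = bit-<ᵇ-antitone x a≤b

bit-<ᵇ-< : ∀ {a x} → a < x → bit (a <ᵇ x) ≡ 1
bit-<ᵇ-< {zero}  {suc x} _         = refl
bit-<ᵇ-< {suc a} {suc x} (s<s a<x) = bit-<ᵇ-< a<x

below-all-≥ : ∀ {n} x (l : List (Fin n)) → All (λ c → x ≤ toℕ c) l → below l x ≡ 0
below-all-≥ x []      []           = refl
below-all-≥ x (c ∷ l) (x≤c ∷ x≤l) = cong₂ _+_ (bit-<ᵇ-≥ x≤c) (below-all-≥ x l x≤l)
  where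
  bit-<ᵇ-≥ : ∀ {a x} → x ≤ a → bit (a <ᵇ x) ≡ 0
  bit-<ᵇ-≥ {_}     {zero}  _         = refl
  bit-<ᵇ-≥ {suc a} {suc x} (s≤s x≤a) = bit-<ᵇ-≥ x≤a

pointwise⇒below-antitone : ∀ {n} {xs ys : List (Fin n)} → Pointwise Fin._≤_ xs ys →
  ∀ x → below ys x ≤ below xs x
pointwise⇒below-antitone []         x = z≤n
pointwise⇒below-antitone (a≤b ∷ ps) x = +-mono-≤ (bit-<ᵇ-antitone x a≤b) (pointwise⇒below-antitone ps x)

below-antitone⇒pointwise : ∀ {n} {xs ys : List (Fin n)} →
  AllPairs Fin._<_ xs → AllPairs Fin._<_ ys → length xs ≡ length ys →
  (∀ x → below ys x ≤ below xs x) → Pointwise Fin._≤_ xs ys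
below-antitone⇒pointwise {xs = []}     {[]}     _          _          _   _ = []
below-antitone⇒pointwise {xs = a ∷ xs} {b ∷ ys} (a<xs ∷ sx) (b<ys ∷ sy) eq below≤ =
  a≤b ∷ below-antitone⇒pointwise sx sy (suc-injective eq) below≤-tail
  where
  -- Were b < a, then b would be counted below b + 1 in b ∷ ys but nothing in a ∷ xs would.
  a≤b : toℕ a ≤ toℕ b
  a≤b with toℕ a ≤? toℕ b
  ... | yes a≤b = a≤b
  ... | no  a≰b =
    ⊥-elim (n≮0 (subst₂ _≤_ (cong (_+ below ys x) (bit-<ᵇ-< {toℕ b} ≤-refl)) xs-none (below≤ x)))
    where
    x : ℕ
    x = suc (toℕ b)
    x≤a : x ≤ toℕ a
    x≤a = ≰⇒> a≰b
    xs-none : below (a ∷ xs) x ≡ 0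
    xs-none = below-all-≥ x (a ∷ xs) (x≤a ∷ All.map (λ a<c → ≤-trans x≤a (<⇒≤ a<c)) a<xs)
  below≤-tail : ∀ x → below ys x ≤ below xs x
  below≤-tail x with toℕ b <? x
  ... | yes b<x = +-cancelˡ-≤ 1 _ _ (subst₂ _≤_ (cong (_+ below ys x) (bit-<ᵇ-< b<x))
                                                 (cong (_+ below xs x) (bit-<ᵇ-< (≤-<-trans a≤b b<x)))
                                                 (below≤ x))
  ... | no  b≮x = ≤-trans (≤-reflexive (below-all-≥ x ys (All.map (λ b<c → ≤-trans (≮⇒≥ b≮x) (<⇒≤ b<c)) b<ys)))
                          z≤n

≤G⇒countBelow-antitone : ∀ {n} (X Y : Subset n) → X ≤G Y → ∀ s → countBelow Y s ≤ countBelow X s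
≤G⇒countBelow-antitone X Y X≤Y s =
  subst₂ _≤_ (sym (countBelow≡below-elems Y s)) (sym (countBelow≡below-elems X s))
             (pointwise⇒below-antitone X≤Y s)

countBelow-antitone⇒≤G : ∀ {n} (X Y : Subset n) → ∣ X ∣ ≡ ∣ Y ∣ →
  (∀ s → s ≤ n → countBelow Y s ≤ countBelow X s) → X ≤G Y
countBelow-antitone⇒≤G {n} X Y ∣X∣≡∣Y∣ counts≤ =
  below-antitone⇒pointwise (elems-sorted X) (elems-sorted Y)
    (trans (length-elems X) (trans ∣X∣≡∣Y∣ (sym (length-elems Y)))) below≤
  where
  below≤ : ∀ x → below (elems Y) x ≤ below (elems X) x
  below≤ x = subst₂ _≤_ (trans (sym (countBelow-⊓ Y x)) (countBelow≡below-elems Y x))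
                        (trans (sym (countBelow-⊓ X x)) (countBelow≡below-elems X x))
                        (counts≤ (x ⊓ n) (m⊓n≤n x n))

-- Bands of prefix counts are lattice path matroids

isLatticePathMatroid-⇔ : ∀ {n k} {𝓑 𝓒 : Subset n → Set} → (∀ R → 𝓑 R ⇔ 𝓒 R) →
  IsLatticePathMatroid n k 𝓑 → IsLatticePathMatroid n k 𝓒
isLatticePathMatroid-⇔ 𝓑⇔𝓒 (A , B , ∣A∣≡k , ∣B∣≡k , A≤B , bases) =
  A , B , ∣A∣≡k , ∣B∣≡k , A≤B ,
  λ R → proj₁ (bases R) ∘ Equivalence.from (𝓑⇔𝓒 R) , Equivalence.to (𝓑⇔𝓒 R) ∘ proj₂ (bases R)

record BetweenCounts {n} (k : ℕ) (lo hi : ℕ → ℕ) (F : Subset n) : Set where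
  constructor between
  field
    card   : ∣ F ∣ ≡ k
    bounds : ∀ s → s ≤ n → lo s ≤ countBelow F s × countBelow F s ≤ hi s

module _ {n k : ℕ} {lo hi : ℕ → ℕ}
         (lo-steps : ∀ s → s < n → UnitStep lo s) (hi-steps : ∀ s → s < n → UnitStep hi s)
         (lo[n]≡k : lo n ≡ k) (hi[n]≡k : hi n ≡ k) where

  -- the pointwise largest and smallest prefix counts of a k-subset lying between lo and hi
  maxCount minCount : ℕ → ℕ
  maxCount s = s ⊓ (k ⊓ hi s)
  minCount s = ((s + k) ∸ n) ⊔ lo s

  countBelow≤maxCount : ∀ {G} → BetweenCounts k lo hi G → ∀ {s} → s ≤ n → countBelow G s ≤ maxCount s
  countBelow≤maxCount {G} (between ∣G∣≡k bounds) {s} s≤n =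
    ⊓-glb (countBelow≤s G s)
          (⊓-glb (subst (countBelow G s ≤_) ∣G∣≡k (countBelow≤∣p∣ G s)) (proj₂ (bounds s s≤n)))

  minCount≤countBelow : ∀ {G} → BetweenCounts k lo hi G → ∀ {s} → s ≤ n → minCount s ≤ countBelow G s
  minCount≤countBelow {G} (between ∣G∣≡k bounds) {s} s≤n =
    ⊔-lub (m≤n+o⇒m∸n≤o (s + k) n
            (subst (λ m → s + m ≤ n + countBelow G s) ∣G∣≡k (s+∣p∣≤n+countBelow G s≤n)))
          (proj₁ (bounds s s≤n))

  maxCount≤hi : ∀ s → maxCount s ≤ hi s
  maxCount≤hi s = ≤-trans (m⊓n≤n s _) (m⊓n≤n k (hi s))

  lo≤minCount : ∀ s → lo s ≤ minCount s
  lo≤minCount s = m≤n⊔m ((s + k) ∸ n) (lo s)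

  module Extremal (F₀ : Subset n) (F₀-between : BetweenCounts k lo hi F₀) where

    k≤n : k ≤ n
    k≤n = subst (_≤ n) (BetweenCounts.card F₀-between) (∣p∣≤n F₀)

    minCount[0]≡0 : minCount 0 ≡ 0
    minCount[0]≡0 = cong₂ _⊔_ (m≤n⇒m∸n≡0 k≤n) lo[0]≡0
      where
      lo[0]≡0 : lo 0 ≡ 0
      lo[0]≡0 = n≤0⇒n≡0 (subst (lo 0 ≤_) (countBelow-zero F₀)
                                (proj₁ (BetweenCounts.bounds F₀-between 0 z≤n)))

    A B : Subset n
    A = fromCounts n maxCount
    B = fromCounts n minCount

    countBelow-A : ∀ {s} → s ≤ n → countBelow A s ≡ maxCount s
    countBelow-A = countBelow-fromCounts n maxCount refl λ s s<n →
      unitStep-⊓ (λ s → s) (λ s → k ⊓ hi s) (unitStep-id s)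
                 (unitStep-⊓ (λ _ → k) hi (unitStep-const k s) (hi-steps s s<n))

    countBelow-B : ∀ {s} → s ≤ n → countBelow B s ≡ minCount s
    countBelow-B = countBelow-fromCounts n minCount minCount[0]≡0 λ s s<n →
      unitStep-⊔ (λ s → (s + k) ∸ n) lo (unitStep-+∸ (λ s → s) k n (unitStep-id s)) (lo-steps s s<n)

    ∣A∣≡k : ∣ A ∣ ≡ k
    ∣A∣≡k = begin
      ∣ A ∣              ≡⟨ ∣p∣≡countBelow A ⟩
      countBelow A n     ≡⟨ countBelow-A ≤-refl ⟩
      n ⊓ (k ⊓ hi n)     ≡⟨ cong (λ h → n ⊓ (k ⊓ h)) hi[n]≡k ⟩
      n ⊓ (k ⊓ k)        ≡⟨ cong (n ⊓_) (⊓-idem k) ⟩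
      n ⊓ k              ≡⟨ m≥n⇒m⊓n≡n k≤n ⟩
      k                  ∎
      where open ≡-Reasoning

    ∣B∣≡k : ∣ B ∣ ≡ k
    ∣B∣≡k = begin
      ∣ B ∣                  ≡⟨ ∣p∣≡countBelow B ⟩
      countBelow B n         ≡⟨ countBelow-B ≤-refl ⟩
      ((n + k) ∸ n) ⊔ lo n   ≡⟨ cong₂ _⊔_ (m+n∸m≡n n k) lo[n]≡k ⟩
      k ⊔ k                  ≡⟨ ⊔-idem k ⟩
      k                      ∎
      where open ≡-Reasoning

    between⇒A≤G : ∀ {R} → BetweenCounts k lo hi R → A ≤G R
    between⇒A≤G {R} R-between =
      countBelow-antitone⇒≤G A R (trans ∣A∣≡k (sym (BetweenCounts.card R-between))) λ s s≤n →
      subst (_ ≤_) (sym (countBelow-A s≤n)) (countBelow≤maxCount R-between s≤n)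

    between⇒≤GB : ∀ {R} → BetweenCounts k lo hi R → R ≤G B
    between⇒≤GB {R} R-between =
      countBelow-antitone⇒≤G R B (trans (BetweenCounts.card R-between) (sym ∣B∣≡k)) λ s s≤n →
      subst (_≤ _) (sym (countBelow-B s≤n)) (minCount≤countBelow R-between s≤n)

    A≤G∧≤GB⇒between : ∀ {R} → ∣ R ∣ ≡ k → A ≤G R → R ≤G B → BetweenCounts k lo hi R
    A≤G∧≤GB⇒between {R} ∣R∣≡k A≤R R≤B = between ∣R∣≡k λ s s≤n →
      ≤-trans (lo≤minCount s)
              (≤-trans (≤-reflexive (sym (countBelow-B s≤n))) (≤G⇒countBelow-antitone R B R≤B s)) ,
      ≤-trans (≤G⇒countBelow-antitone A R A≤R s)
              (≤-trans (≤-reflexive (countBelow-A s≤n)) (maxCount≤hi s))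

    B-between : BetweenCounts k lo hi B
    B-between = between ∣B∣≡k λ s s≤n →
      subst (lo s ≤_) (sym (countBelow-B s≤n)) (lo≤minCount s) ,
      subst (_≤ hi s) (sym (countBelow-B s≤n))
            (≤-trans (minCount≤countBelow F₀-between s≤n) (proj₂ (BetweenCounts.bounds F₀-between s s≤n)))

  betweenCounts-isLatticePathMatroid : ∃ (BetweenCounts k lo hi) →
    IsLatticePathMatroid n k (BetweenCounts k lo hi)
  betweenCounts-isLatticePathMatroid (F₀ , F₀-between) =
    A , B , ∣A∣≡k , ∣B∣≡k , between⇒A≤G B-between ,
    λ R → (λ R-between → BetweenCounts.card R-between , between⇒A≤G R-between , between⇒≤GB R-between) ,
          (λ (∣R∣≡k , A≤R , R≤B) → A≤G∧≤GB⇒between ∣R∣≡k A≤R R≤B)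
    where open Extremal F₀ F₀-between

-- A symmetric path is determined by the second half of its word

prefixSum : (ℕ → ℕ) → ℕ → ℕ
prefixSum f zero    = 0
prefixSum f (suc t) = prefixSum f t + f t

prefixSum-const0 : ∀ t → prefixSum (λ _ → 0) t ≡ 0
prefixSum-const0 zero    = refl
prefixSum-const0 (suc t) = trans (+-identityʳ _) (prefixSum-const0 t)

prefixSum-suc : ∀ f t → prefixSum f (suc t) ≡ f 0 + prefixSum (f ∘ suc) t
prefixSum-suc f zero    = +-comm 0 (f 0)
prefixSum-suc f (suc t) = trans (cong (_+ f (suc t)) (prefixSum-suc f t)) (+-assoc (f 0) _ _)

prefixSum-cong : ∀ {f g} → (∀ i → f i ≡ g i) → ∀ t → prefixSum f t ≡ prefixSum g t
prefixSum-cong f≗g zero    = refl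
prefixSum-cong f≗g (suc t) = cong₂ _+_ (prefixSum-cong f≗g t) (f≗g t)

prefixSum-+ : ∀ f m s → prefixSum f (m + s) ≡ prefixSum f m + prefixSum (λ j → f (m + j)) s
prefixSum-+ f m zero    = trans (cong (prefixSum f) (+-identityʳ m)) (sym (+-identityʳ _))
prefixSum-+ f m (suc s) = begin
  prefixSum f (m + suc s)                                      ≡⟨ cong (prefixSum f) (+-suc m s) ⟩
  prefixSum f (m + s) + f (m + s)                              ≡⟨ cong (_+ f (m + s)) (prefixSum-+ f m s) ⟩
  prefixSum f m + prefixSum (λ j → f (m + j)) s + f (m + s)    ≡⟨ +-assoc (prefixSum f m) _ _ ⟩
  prefixSum f m + (prefixSum (λ j → f (m + j)) s + f (m + s))  ∎
  where open ≡-Reasoning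

-- Steps are indexed by ℕ; past the end of the word we read N, which adds no E step.
stepAt : List Step → ℕ → Step
stepAt []      _       = N
stepAt (x ∷ _) zero    = x
stepAt (_ ∷ l) (suc i) = stepAt l i

stepAt-toList : ∀ {m} (w : Vec Step m) i → stepAt (toList w) (toℕ i) ≡ lookup w i
stepAt-toList (_ ∷ _) Fin.zero    = refl
stepAt-toList (_ ∷ w) (Fin.suc i) = stepAt-toList w i

stepAt-≥length : ∀ l {i} → length l ≤ i → stepAt l i ≡ N
stepAt-≥length []      _         = refl
stepAt-≥length (_ ∷ l) (s≤s l≤i) = stepAt-≥length l l≤i

countE-take : ∀ l t → countE (take t l) ≡ prefixSum (bit ∘ isE ∘ stepAt l) t
countE-take []      zero    = refl
countE-take []      (suc t) = sym (trans (+-identityʳ _) (prefixSum-const0 t))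
countE-take (_ ∷ _) zero    = refl
countE-take (x ∷ l) (suc t) = trans (countE-∷ x) (trans (cong (bit (isE x) +_) (countE-take l t))
                                                        (sym (prefixSum-suc (bit ∘ isE ∘ stepAt (x ∷ l)) t)))
  where
  countE-∷ : ∀ x → countE (x ∷ take t l) ≡ bit (isE x) + countE (take t l)
  countE-∷ E = refl
  countE-∷ N = refl

memberAt : ∀ {n} → Subset n → ℕ → Bool
memberAt []      _       = false
memberAt (b ∷ _) zero    = b
memberAt (_ ∷ F) (suc j) = memberAt F j

memberAt-toℕ : ∀ {n} (F : Subset n) i → memberAt F (toℕ i) ≡ lookup F i
memberAt-toℕ (_ ∷ _) Fin.zero    = refl
memberAt-toℕ (_ ∷ F) (Fin.suc i) = memberAt-toℕ F i

memberAt-≥ : ∀ {n} (F : Subset n) {j} → n ≤ j → memberAt F j ≡ false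
memberAt-≥ []      _         = refl
memberAt-≥ (_ ∷ F) (s≤s n≤j) = memberAt-≥ F n≤j

countBelow≡prefixSum : ∀ {n} (F : Subset n) s → countBelow F s ≡ prefixSum (bit ∘ memberAt F) s
countBelow≡prefixSum []      s       = sym (prefixSum-const0 s)
countBelow≡prefixSum (_ ∷ _) zero    = refl
countBelow≡prefixSum (b ∷ F) (suc s) =
  trans (cong (bit b +_) (countBelow≡prefixSum F s)) (sym (prefixSum-suc (bit ∘ memberAt (b ∷ F)) s))

-- labL∩ r is definitionally secondHalf (word r).
secondHalf : ∀ {n} → Word n → Subset n
secondHalf {n} w = tabulate (λ j → isE (lookup w (n ↑ʳ j)))

module SymmetricWord {n : ℕ} (w : Word n) (w-sym : IsSymmetric n w) where

  private
    F : Subset n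
    F = secondHalf w

    e : ℕ → ℕ
    e = bit ∘ isE ∘ stepAt (toList w)

  eAfter≡prefixSum : ∀ t → eAfter n w t ≡ prefixSum e t
  eAfter≡prefixSum = countE-take (toList w)

  countBelow-secondHalf : ∀ s → countBelow F s ≡ prefixSum (λ j → e (n + j)) s
  countBelow-secondHalf s = trans (countBelow≡prefixSum F s) (prefixSum-cong member≡e s)
    where
    member≡e : ∀ j → bit (memberAt F j) ≡ e (n + j)
    member≡e j with j <? n
    ... | yes j<n = begin
      bit (memberAt F j)                     ≡⟨ cong (bit ∘ memberAt F) (sym (toℕ-fromℕ< j<n)) ⟩
      bit (memberAt F (toℕ i))               ≡⟨ cong bit (trans (memberAt-toℕ F i) (lookup∘tabulate _ i)) ⟩
      bit (isE (lookup w (n ↑ʳ i)))          ≡⟨ cong (bit ∘ isE) (sym (stepAt-toList w (n ↑ʳ i))) ⟩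
      e (toℕ (n ↑ʳ i))                       ≡⟨ cong e (trans (toℕ-↑ʳ n i) (cong (n +_) (toℕ-fromℕ< j<n))) ⟩
      e (n + j)                              ∎
      where
      open ≡-Reasoning
      i : Fin n
      i = fromℕ< j<n
    ... | no j≮n = trans (cong bit (memberAt-≥ F (≮⇒≥ j≮n)))
                   (sym (cong (bit ∘ isE) (stepAt-≥length (toList w)
                          (≤-trans (≤-reflexive (length-toList w)) (+-monoʳ-≤ n (≮⇒≥ j≮n))))))

  countBelow-secondHalf-suc : ∀ u → countBelow F (suc u) ≡ countBelow F u + e (n + u)
  countBelow-secondHalf-suc u =
    trans (countBelow-secondHalf (suc u)) (cong (_+ e (n + u)) (sym (countBelow-secondHalf u)))

  mirror : ∀ {v u} → suc v + u ≡ n → e v + e (n + u) ≡ 1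
  mirror {v} {u} eq =
    subst₂ (λ x y → bit (isE x) + bit (isE y) ≡ 1) (sym step-v) (sym step-n+u) (distinct (w-sym i i<n))
    where
    v<n : v < n
    v<n = subst (v <_) eq (s≤s (m≤m+n v u))
    v<n+n : v < n + n
    v<n+n = ≤-trans v<n (m≤m+n n n)
    i : Fin (n + n)
    i = fromℕ< v<n+n
    i<n : toℕ i < n
    i<n = subst (_< n) (sym (toℕ-fromℕ< v<n+n)) v<n
    step-v : stepAt (toList w) v ≡ lookup w i
    step-v = trans (cong (stepAt (toList w)) (sym (toℕ-fromℕ< v<n+n))) (stepAt-toList w i)
    opposite-i : toℕ (opposite i) ≡ n + u
    opposite-i = begin
      toℕ (opposite i)         ≡⟨ opposite-prop i ⟩
      (n + n) ∸ suc (toℕ i)    ≡⟨ cong (λ t → (n + n) ∸ suc t) (toℕ-fromℕ< v<n+n) ⟩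
      (n + n) ∸ suc v          ≡⟨ +-∸-assoc n v<n ⟩
      n + (n ∸ suc v)          ≡⟨ cong (λ m → n + (m ∸ suc v)) (sym eq) ⟩
      n + (suc v + u ∸ suc v)  ≡⟨ cong (n +_) (m+n∸m≡n (suc v) u) ⟩
      n + u                    ∎
      where open ≡-Reasoning
    step-n+u : stepAt (toList w) (n + u) ≡ lookup w (opposite i)
    step-n+u = trans (cong (stepAt (toList w)) (sym opposite-i)) (stepAt-toList w (opposite i))
    distinct : ∀ {x y} → x ≢ y → bit (isE x) + bit (isE y) ≡ 1
    distinct {E} {E} x≢y = ⊥-elim (x≢y refl)
    distinct {E} {N} _   = refl
    distinct {N} {E} _   = refl
    distinct {N} {N} x≢y = ⊥-elim (x≢y refl)

  -- Steps v, …, n-1 mirror steps n, …, n+u-1, so exactly u minus the E steps among the latter are E.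
  prefixSum+∣secondHalf∣ : ∀ v u → v + u ≡ n → prefixSum e v + ∣ F ∣ ≡ v + countBelow F u
  prefixSum+∣secondHalf∣ zero    u eq = trans (∣p∣≡countBelow F) (cong (countBelow F) (sym eq))
  prefixSum+∣secondHalf∣ (suc v) u eq = begin
    prefixSum e v + e v + ∣ F ∣             ≡⟨ xy∙z≈xz∙y (prefixSum e v) (e v) ∣ F ∣ ⟩
    prefixSum e v + ∣ F ∣ + e v             ≡⟨ cong (_+ e v) (prefixSum+∣secondHalf∣ v (suc u) (trans (+-suc v u) eq)) ⟩
    v + countBelow F (suc u) + e v          ≡⟨ cong (λ c → v + c + e v) (countBelow-secondHalf-suc u) ⟩
    v + (countBelow F u + e (n + u)) + e v  ≡⟨ +-assoc v _ (e v) ⟩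
    v + (countBelow F u + e (n + u) + e v)  ≡⟨ cong (v +_) (xy∙z≈x∙zy (countBelow F u) (e (n + u)) (e v)) ⟩
    v + (countBelow F u + (e v + e (n + u))) ≡⟨ cong (λ m → v + (countBelow F u + m)) (mirror eq) ⟩
    v + (countBelow F u + 1)                ≡⟨ cong (v +_) (+-comm (countBelow F u) 1) ⟩
    v + suc (countBelow F u)                ≡⟨ +-suc v (countBelow F u) ⟩
    suc v + countBelow F u                  ∎
    where open ≡-Reasoning

  eAfter-firstHalf : ∀ {t} → t ≤ n → eAfter n w t + ∣ F ∣ ≡ t + countBelow F (n ∸ t)
  eAfter-firstHalf {t} t≤n =
    trans (cong (_+ ∣ F ∣) (eAfter≡prefixSum t)) (prefixSum+∣secondHalf∣ t (n ∸ t) (m+[n∸m]≡n t≤n))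

  eAfter-secondHalf : ∀ s → eAfter n w (n + s) + ∣ F ∣ ≡ n + countBelow F s
  eAfter-secondHalf s = begin
    eAfter n w (n + s) + ∣ F ∣              ≡⟨ cong (_+ ∣ F ∣) (eAfter≡prefixSum (n + s)) ⟩
    prefixSum e (n + s) + ∣ F ∣             ≡⟨ cong (_+ ∣ F ∣) (prefixSum-+ e n s) ⟩
    prefixSum e n + prefixSum (λ j → e (n + j)) s + ∣ F ∣
                                            ≡⟨ cong (λ c → prefixSum e n + c + ∣ F ∣) (sym (countBelow-secondHalf s)) ⟩
    prefixSum e n + countBelow F s + ∣ F ∣  ≡⟨ xy∙z≈xz∙y (prefixSum e n) (countBelow F s) ∣ F ∣ ⟩
    prefixSum e n + ∣ F ∣ + countBelow F s  ≡⟨ cong (_+ countBelow F s) (prefixSum+∣secondHalf∣ n 0 (+-identityʳ n)) ⟩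
    n + countBelow F 0 + countBelow F s     ≡⟨ cong (λ c → n + c + countBelow F s) (countBelow-zero F) ⟩
    n + 0 + countBelow F s                  ≡⟨ cong (_+ countBelow F s) (+-identityʳ n) ⟩
    n + countBelow F s                      ∎
    where open ≡-Reasoning

_≼ᶜ_ : ∀ {n} → Subset n → Subset n → Set
_≼ᶜ_ {n} X Y = ∀ s → s ≤ n → countBelow Y s + ∣ X ∣ ≤ countBelow X s + ∣ Y ∣

≼ᶜ-everywhere : ∀ {n} (X Y : Subset n) → X ≼ᶜ Y → ∀ s → countBelow Y s + ∣ X ∣ ≤ countBelow X s + ∣ Y ∣
≼ᶜ-everywhere {n} X Y X≼Y s =
  subst₂ (λ y x → y + ∣ X ∣ ≤ x + ∣ Y ∣) (sym (countBelow-⊓ Y s)) (sym (countBelow-⊓ X s))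
         (X≼Y (s ⊓ n) (m⊓n≤n s n))

≤⇔offset : ∀ {X Y c b b′ a a′} → X + a ≡ c + b → Y + a′ ≡ c + b′ → (X ≤ Y ⇔ b + a′ ≤ b′ + a)
≤⇔offset {X} {Y} {c} {b} {b′} {a} {a′} X+a≡c+b Y+a′≡c+b′ = mk⇔
  (λ X≤Y → +-cancelˡ-≤ c _ _ (subst₂ _≤_ X-shift Y-shift (+-monoˡ-≤ (a + a′) X≤Y)))
  (λ b≤b′ → +-cancelʳ-≤ (a + a′) X Y (subst₂ _≤_ (sym X-shift) (sym Y-shift) (+-monoʳ-≤ c b≤b′)))
  where
  open ≡-Reasoning
  X-shift : X + (a + a′) ≡ c + (b + a′)
  X-shift = begin
    X + (a + a′)  ≡⟨ sym (+-assoc X a a′) ⟩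
    X + a + a′    ≡⟨ cong (_+ a′) X+a≡c+b ⟩
    c + b + a′    ≡⟨ +-assoc c b a′ ⟩
    c + (b + a′)  ∎
  Y-shift : Y + (a + a′) ≡ c + (b′ + a)
  Y-shift = begin
    Y + (a + a′)  ≡⟨ cong (Y +_) (+-comm a a′) ⟩
    Y + (a′ + a)  ≡⟨ sym (+-assoc Y a′ a) ⟩
    Y + a′ + a    ≡⟨ cong (_+ a) Y+a′≡c+b′ ⟩
    c + b′ + a    ≡⟨ +-assoc c b′ a ⟩
    c + (b′ + a)  ∎

≼⇔≼ᶜ : ∀ {n} (x r : SymPath n) → x ≼ r ⇔ labL∩ x ≼ᶜ labL∩ r
≼⇔≼ᶜ {n} x r = mk⇔
  (λ x≼r s _ → Equivalence.to (secondHalf-offset s) (x≼r (n + s)))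
  (λ x≼ᶜr → eAfter≤ (≼ᶜ-everywhere (labL∩ x) (labL∩ r) x≼ᶜr))
  where
  module X = SymmetricWord (word x) (isSym x)
  module R = SymmetricWord (word r) (isSym r)

  EAfterBelow : ℕ → Set
  EAfterBelow t = eAfter n (word r) t ≤ eAfter n (word x) t

  CountsBelow : ℕ → Set
  CountsBelow s = countBelow (labL∩ r) s + ∣ labL∩ x ∣ ≤ countBelow (labL∩ x) s + ∣ labL∩ r ∣

  secondHalf-offset : ∀ s → EAfterBelow (n + s) ⇔ CountsBelow s
  secondHalf-offset s = ≤⇔offset (R.eAfter-secondHalf s) (X.eAfter-secondHalf s)

  eAfter≤ : (∀ s → CountsBelow s) → ∀ t → EAfterBelow t
  eAfter≤ counts≤ t with t ≤? n
  ... | yes t≤n = Equivalence.from (≤⇔offset (R.eAfter-firstHalf t≤n) (X.eAfter-firstHalf t≤n))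
                                   (counts≤ (n ∸ t))
  ... | no  t≰n = subst EAfterBelow (m+[n∸m]≡n (≰⇒≥ t≰n))
                        (Equivalence.from (secondHalf-offset (t ∸ n)) (counts≤ (t ∸ n)))

flipStep : Step → Step
flipStep E = N
flipStep N = E

flipStep≢ : ∀ x → flipStep x ≢ x
flipStep≢ E ()
flipStep≢ N ()

toStep : Bool → Step
toStep true  = E
toStep false = N

isE-toStep : ∀ b → isE (toStep b) ≡ b
isE-toStep true  = refl
isE-toStep false = refl

opposite-↑ˡ : ∀ {n} (j : Fin n) → opposite (j ↑ˡ n) ≡ n ↑ʳ opposite j
opposite-↑ˡ {n} j = toℕ-injective (begin
  toℕ (opposite (j ↑ˡ n))       ≡⟨ opposite-prop (j ↑ˡ n) ⟩
  (n + n) ∸ suc (toℕ (j ↑ˡ n))  ≡⟨ cong (λ i → (n + n) ∸ suc i) (toℕ-↑ˡ j n) ⟩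
  (n + n) ∸ suc (toℕ j)         ≡⟨ +-∸-assoc n (toℕ<n j) ⟩
  n + (n ∸ suc (toℕ j))         ≡⟨ cong (n +_) (sym (opposite-prop j)) ⟩
  n + toℕ (opposite j)          ≡⟨ sym (toℕ-↑ʳ n (opposite j)) ⟩
  toℕ (n ↑ʳ opposite j)         ∎)
  where open ≡-Reasoning

module FromSecondHalf {n : ℕ} (F : Subset n) where

  private
    stepOf : Fin n → Step
    stepOf = toStep ∘ lookup F

    pick : Fin n ⊎ Fin n → Step
    pick = [ flipStep ∘ stepOf ∘ opposite , stepOf ]

    w : Word n
    w = tabulate (pick ∘ splitAt n)

    lookup-↑ˡ : ∀ j → lookup w (j ↑ˡ n) ≡ flipStep (stepOf (opposite j))
    lookup-↑ˡ j = trans (lookup∘tabulate _ (j ↑ˡ n)) (cong pick (splitAt-↑ˡ n j n))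

    lookup-↑ʳ : ∀ j → lookup w (n ↑ʳ j) ≡ stepOf j
    lookup-↑ʳ j = trans (lookup∘tabulate _ (n ↑ʳ j)) (cong pick (splitAt-↑ʳ n n j))

    w-sym : IsSymmetric n w
    w-sym i i<n with splitAt n i in split
    ... | inj₁ j = subst (λ i → lookup w i ≢ lookup w (opposite i)) (splitAt⁻¹-↑ˡ split) λ eq →
                     flipStep≢ _ (trans (sym (lookup-↑ˡ j))
                                  (trans eq (trans (cong (lookup w) (opposite-↑ˡ j)) (lookup-↑ʳ (opposite j)))))
    ... | inj₂ j = ⊥-elim (<⇒≱ i<n (subst (n ≤_) (trans (sym (toℕ-↑ʳ n j)) (cong toℕ (splitAt⁻¹-↑ʳ split)))
                                          (m≤m+n n (toℕ j))))

    w-path : IsLatticePath n w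
    w-path = +-cancelʳ-≡ _ _ _ (trans (SymmetricWord.eAfter-secondHalf {n} w w-sym n)
                                      (cong (n +_) (sym (∣p∣≡countBelow (secondHalf {n} w)))))

  fromSecondHalf : SymPath n
  fromSecondHalf = mkSymPath w w-path w-sym

  labL∩-fromSecondHalf : labL∩ fromSecondHalf ≡ F
  labL∩-fromSecondHalf =
    trans (tabulate-cong λ j → trans (cong isE (lookup-↑ʳ j)) (isE-toStep (lookup F j))) (tabulate∘lookup F)

open FromSecondHalf public

-- The homogeneous components

module ComponentBases {n : ℕ} (p q : SymPath n) (k : ℕ) where

  upper lower : ℕ → ℕ
  upper s = (countBelow (labL∩ p) s + k) ∸ ∣ labL∩ p ∣
  lower s = (countBelow (labL∩ q) s + k) ∸ ∣ labL∩ q ∣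

  upper-steps : ∀ s → s < n → UnitStep upper s
  upper-steps s _ = unitStep-+∸ (countBelow (labL∩ p)) k ∣ labL∩ p ∣ (countBelow-unitStep (labL∩ p) s)

  lower-steps : ∀ s → s < n → UnitStep lower s
  lower-steps s _ = unitStep-+∸ (countBelow (labL∩ q)) k ∣ labL∩ q ∣ (countBelow-unitStep (labL∩ q) s)

  upper[n]≡k : upper n ≡ k
  upper[n]≡k = trans (cong (λ c → (c + k) ∸ ∣ labL∩ p ∣) (sym (∣p∣≡countBelow (labL∩ p))))
                     (m+n∸m≡n ∣ labL∩ p ∣ k)

  lower[n]≡k : lower n ≡ k
  lower[n]≡k = trans (cong (λ c → (c + k) ∸ ∣ labL∩ q ∣) (sym (∣p∣≡countBelow (labL∩ q))))
                     (m+n∸m≡n ∣ labL∩ q ∣ k)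

  -- upper is defined with truncated subtraction; this says the truncation never happens.
  UpperUntruncated : Set
  UpperUntruncated = ∀ s → s ≤ n → ∣ labL∩ p ∣ ≤ countBelow (labL∩ p) s + k

  ≼ᶜ⇔≤upper : ∀ F → ∣ F ∣ ≡ k → UpperUntruncated → labL∩ p ≼ᶜ F ⇔ (∀ s → s ≤ n → countBelow F s ≤ upper s)
  ≼ᶜ⇔≤upper F ∣F∣≡k ∣p∣≤ = mk⇔
    (λ p≼F s s≤n → m+n≤o⇒m≤o∸n (countBelow F s)
                     (subst (λ m → _ ≤ countBelow (labL∩ p) s + m) ∣F∣≡k (p≼F s s≤n)))
    (λ F≤upper s s≤n → subst (λ m → _ ≤ countBelow (labL∩ p) s + m) (sym ∣F∣≡k)
                         (m≤o∸n⇒m+n≤o (countBelow F s) (∣p∣≤ s s≤n) (F≤upper s s≤n)))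

  ≼ᶜ⇔lower≤ : ∀ F → ∣ F ∣ ≡ k → F ≼ᶜ labL∩ q ⇔ (∀ s → s ≤ n → lower s ≤ countBelow F s)
  ≼ᶜ⇔lower≤ F ∣F∣≡k = mk⇔
    (λ F≼q s s≤n → m≤n+o⇒m∸n≤o (countBelow (labL∩ q) s + k) ∣ labL∩ q ∣
                     (subst₂ _≤_ (cong (countBelow (labL∩ q) s +_) ∣F∣≡k) (+-comm (countBelow F s) _) (F≼q s s≤n)))
    (λ lower≤F s s≤n → subst₂ _≤_ (cong (countBelow (labL∩ q) s +_) (sym ∣F∣≡k))
                                   (+-comm ∣ labL∩ q ∣ (countBelow F s))
                         (≤-trans (m≤n+m∸n _ ∣ labL∩ q ∣) (+-monoʳ-≤ ∣ labL∩ q ∣ (lower≤F s s≤n))))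

  componentBasis⇒upperUntruncated : ∀ {F} → ComponentBasis p q k F → UpperUntruncated
  componentBasis⇒upperUntruncated ((r , p≼r , _ , refl) , ∣F∣≡k) s s≤n =
    ≤-trans (m≤n+m ∣ labL∩ p ∣ (countBelow (labL∩ r) s))
            (subst (λ m → _ ≤ countBelow (labL∩ p) s + m) ∣F∣≡k (Equivalence.to (≼⇔≼ᶜ p r) p≼r s s≤n))

  componentBasis⇔betweenCounts : UpperUntruncated →
    ∀ F → ComponentBasis p q k F ⇔ BetweenCounts k lower upper F
  componentBasis⇔betweenCounts ∣p∣≤ F = mk⇔ toBetween fromBetween
    where
    toBetween : ComponentBasis p q k F → BetweenCounts k lower upper F
    toBetween ((r , p≼r , r≼q , refl) , ∣F∣≡k) = between ∣F∣≡k λ s s≤n →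
      Equivalence.to (≼ᶜ⇔lower≤ (labL∩ r) ∣F∣≡k) (Equivalence.to (≼⇔≼ᶜ r q) r≼q) s s≤n ,
      Equivalence.to (≼ᶜ⇔≤upper (labL∩ r) ∣F∣≡k ∣p∣≤) (Equivalence.to (≼⇔≼ᶜ p r) p≼r) s s≤n
    fromBetween : BetweenCounts k lower upper F → ComponentBasis p q k F
    fromBetween (between ∣F∣≡k bounds) = (r , p≼r , r≼q , labL∩-fromSecondHalf F) , ∣F∣≡k
      where
      r : SymPath n
      r = fromSecondHalf F
      p≼r : p ≼ r
      p≼r = Equivalence.from (≼⇔≼ᶜ p r) (subst (labL∩ p ≼ᶜ_) (sym (labL∩-fromSecondHalf F))
              (Equivalence.from (≼ᶜ⇔≤upper F ∣F∣≡k ∣p∣≤) λ s s≤n → proj₂ (bounds s s≤n)))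
      r≼q : r ≼ q
      r≼q = Equivalence.from (≼⇔≼ᶜ r q) (subst (_≼ᶜ labL∩ q) (sym (labL∩-fromSecondHalf F))
              (Equivalence.from (≼ᶜ⇔lower≤ F ∣F∣≡k) λ s s≤n → proj₁ (bounds s s≤n)))

corollary3p16 : (n : ℕ) (p q : SymPath n) → p ≼ q → (k : ℕ) →
    ∃ (λ (F : Subset n) → ComponentBasis p q k F) →
    IsLatticePathMatroid n k (ComponentBasis p q k)
corollary3p16 n p q _ k (F₀ , F₀-basis) =
  isLatticePathMatroid-⇔ (λ F → ⇔.sym (componentBasis⇔betweenCounts ∣p∣≤ F))
    (betweenCounts-isLatticePathMatroid lower-steps upper-steps lower[n]≡k upper[n]≡k
      (F₀ , Equivalence.to (componentBasis⇔betweenCounts ∣p∣≤ F₀) F₀-basis))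
  where
  open ComponentBases p q k
  ∣p∣≤ : UpperUntruncated
  ∣p∣≤ = componentBasis⇒upperUntruncated F₀-basis
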